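{- Let $n\ge 1$ and $k\ge 0$ be integers. Let $\overline{HA}_{n,k-1}$ be the set of pairs $[\sigma,a]$ with $\sigma\in\mathcal{Q}_n$, $\mathrm{asc}(\sigma)=k-1$ and $a\in\{1,2,\dots,n\}$. Let $\overline{RFA}_{n+1,k}$ be the set of pairs $[\pi,i]$ with $\pi\in\mathcal{Q}_{n+1}$, $\mathrm{asc}(\pi)=k$, $i\in\{1,\dots,k\}\cup\{n+1\}$ and $i\in\{1,2,\dots,\pi^{ -1}(n+1)-1\}$. Then there is a bijection from $\overline{HA}_{n,k-1}$ onto $\overline{RFA}_{n+1,k}$.
   Context: Permutations of $[m]=\{1,\dots,m\}$ are written as words $\pi(1)\cdots\pi(m)$. $\mathrm{asc}(\pi)$ is the number of indices $i\in[m-1]$ with $\pi(i)<\pi(i+1)$. $\mathcal{Q}_m$ denotes the set of permutations $\pi$ of $[m]$ such that $\pi(1)<\pi(2)<\cdots<\pi(p)$ where $p=\pi^{ -1}(m)$ (the identity permutation being included). -}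

module Defs where

open import Data.Nat using (ℕ; zero; suc; _+_; _≤_; _<_)
open import Data.Nat.Properties using (_<?_; _≟_)
open import Data.List using (List; []; _∷_; take; length; applyUpTo)
open import Data.List.Relation.Unary.All using (All)
open import Data.List.Relation.Unary.Linked using (Linked)
open import Data.Product using (Σ; _×_)
open import Data.Sum using (_⊎_)
open import Relation.Binary.PropositionalEquality using (_≡_)
open import Relation.Nullary.Decidable using (does)
open import Data.Bool using (if_then_else_)

[1…_] : ℕ → List ℕ
[1… m ] = applyUpTo suc m

count : ℕ → List ℕ → ℕ
count j []       = 0
count j (x ∷ xs) = (if does (x ≟ j) then 1 else 0) + count j xs

-- a word w is (the one-line notation of) a permutation of [m]:
-- every letter lies in [m] and every element of [m] occurs exactly once
IsPerm : ℕ → List ℕ → Set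
IsPerm m w = All (λ x → 1 ≤ x × x ≤ m) w × All (λ j → count j w ≡ 1) [1… m ]

asc : List ℕ → ℕ
asc []           = 0
asc (x ∷ [])     = 0
asc (x ∷ y ∷ ys) = (if does (x <? y) then 1 else 0) + asc (y ∷ ys)

-- 1-based position of the first occurrence of x in w  (π⁻¹(x) for a permutation)
pos : ℕ → List ℕ → ℕ
pos x []       = 0
pos x (y ∷ ys) = if does (x ≟ y) then 1 else suc (pos x ys)

Increasing : List ℕ → Set
Increasing = Linked _<_

Q : ℕ → List ℕ → Set
Q m π = IsPerm m π × Increasing (take (pos m π) π)

-- \overline{HA}_{n,k-1}: pairs [σ,a], σ ∈ 𝒬_n, asc σ = k-1, a ∈ [n]
-- (asc σ = k - 1 is written asc σ + 1 ≡ k, so the set is empty for k = 0)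
HA : ℕ → ℕ → Set
HA n k = Σ (List ℕ × ℕ) λ where
  (σ Data.Product., a) → Q n σ × (asc σ + 1 ≡ k) × (1 ≤ a × a ≤ n)

RFA : ℕ → ℕ → Set
RFA n k = Σ (List ℕ × ℕ) λ where
  (π Data.Product., i) → Q (suc n) π × (asc π ≡ k)
                        × ((1 ≤ i × i ≤ k) ⊎ i ≡ suc n)
                        × (1 ≤ i × i < pos (suc n) π)

-- [σ, a] ↦ [π, i]: raise every letter ≥ a of σ by one, insert a into the
-- increasing run that ends at the maximum (at its sorted place), and let i be
-- the position of a in π; the inverse reads b = π(i), deletes it and lowers the
-- letters above b.  A permutation in 𝒬_m has the shape u m t with u m increasing
-- and t below m, so its ascents number |u| + asc t.  Inserting a lengthens u by
-- one and relabels t monotonically, hence asc π = asc σ + 1, and positions before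
-- the maximum are at most |u| ≤ asc π: these are exactly the admissible i.

module Submission where

open import Defs
open import Data.Bool using (true; false; if_then_else_)
open import Data.Empty using (⊥-elim)
open import Data.List using (List; []; _∷_; _++_; length; map; take)
open import Data.List.Properties using (map-++; length-map)
open import Data.List.Relation.Unary.All as All using (All; []; _∷_)
import Data.List.Relation.Unary.All.Properties as All
open import Data.List.Relation.Unary.AllPairs using (AllPairs; []; _∷_)
import Data.List.Relation.Unary.Linked as Linked
open import Data.List.Relation.Unary.Linked.Properties using (AllPairs⇒Linked; Linked⇒AllPairs)
open import Data.Nat
open import Data.Nat.Properties
open import Algebra.Properties.CommutativeSemigroup +-commutativeSemigroup using (x∙yz≈y∙xz)
open import Data.Product using (Σ-syntax; _×_; _,_; proj₁; proj₂)
open import Data.Product.Properties using (Σ-≡,≡→≡)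
open import Data.Sum using (_⊎_; inj₁; inj₂)
open import Data.Unit using (⊤)
open import Function.Base using (_∘_)
open import Function.Bundles using (_⤖_; mk↔ₛ′)
open import Function.Properties.Inverse using (↔⇒⤖)
open import Relation.Binary.Definitions using (tri<; tri≈; tri>)
open import Relation.Binary.PropositionalEquality
open import Relation.Nullary using (¬_; yes; no; does; Irrelevant)
open import Relation.Nullary.Decidable using (dec-true; dec-false)

count-here : ∀ j xs → count j (j ∷ xs) ≡ suc (count j xs)
count-here j xs rewrite dec-true (j ≟ j) refl = refl

count-there : ∀ j {x} xs → x ≢ j → count j (x ∷ xs) ≡ count j xs
count-there j {x} xs x≢j rewrite dec-false (x ≟ j) x≢j = refl

pos-here : ∀ x ys → pos x (x ∷ ys) ≡ 1
pos-here x ys rewrite dec-true (x ≟ x) refl = refl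

pos-there : ∀ x {y} ys → x ≢ y → pos x (y ∷ ys) ≡ suc (pos x ys)
pos-there x {y} ys x≢y rewrite dec-false (x ≟ y) x≢y = refl

asc-< : ∀ {x y} ys → x < y → asc (x ∷ y ∷ ys) ≡ suc (asc (y ∷ ys))
asc-< {x} {y} ys x<y rewrite dec-true (x <? y) x<y = refl

asc-≮ : ∀ {x y} ys → ¬ x < y → asc (x ∷ y ∷ ys) ≡ asc (y ∷ ys)
asc-≮ {x} {y} ys x≮y rewrite dec-false (x <? y) x≮y = refl

count-++ : ∀ j xs ys → count j (xs ++ ys) ≡ count j xs + count j ys
count-++ j []       ys = refl
count-++ j (x ∷ xs) ys with x ≟ j
... | yes refl rewrite count-here x (xs ++ ys) | count-here x xs = cong suc (count-++ x xs ys)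
... | no x≢j   rewrite count-there j (xs ++ ys) x≢j | count-there j xs x≢j = count-++ j xs ys

count≡0⇒All≢ : ∀ j xs → count j xs ≡ 0 → All (_≢ j) xs
count≡0⇒All≢ j []       _ = []
count≡0⇒All≢ j (x ∷ xs) c with x ≟ j
... | yes refl rewrite count-here x xs = ⊥-elim (1+n≢0 c)
... | no x≢j   rewrite count-there j xs x≢j = x≢j ∷ count≡0⇒All≢ j xs c

All≢⇒count≡0 : ∀ j xs → All (_≢ j) xs → count j xs ≡ 0
All≢⇒count≡0 j []       _            = refl
All≢⇒count≡0 j (x ∷ xs) (x≢j ∷ xs≢j) = trans (count-there j xs x≢j) (All≢⇒count≡0 j xs xs≢j)

All-count>0 : ∀ {P : ℕ → Set} b xs → All P xs → 0 < count b xs → P b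
All-count>0 b (x ∷ xs) (px ∷ pxs) c with x ≟ b
... | yes refl = px
... | no x≢b   rewrite count-there b xs x≢b = All-count>0 b xs pxs c

count-map : ∀ (P : ℕ → Set) f j j′ xs → All P xs →
            (∀ {x} → P x → f x ≡ j → x ≡ j′) → (∀ {x} → P x → x ≡ j′ → f x ≡ j) →
            count j (map f xs) ≡ count j′ xs
count-map P f j j′ []       _          _    _    = refl
count-map P f j j′ (x ∷ xs) (px ∷ pxs) from to with f x ≟ j | x ≟ j′
... | yes refl | yes refl rewrite count-here (f x) (map f xs) | count-here x xs =
  cong suc (count-map P f (f x) x xs pxs from to)
... | yes fx≡j | no x≢j′   = ⊥-elim (x≢j′ (from px fx≡j))
... | no fx≢j  | yes x≡j′  = ⊥-elim (fx≢j (to px x≡j′))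
... | no fx≢j  | no x≢j′   rewrite count-there j (map f xs) fx≢j | count-there j′ xs x≢j′ =
  count-map P f j j′ xs pxs from to

insert : ℕ → List ℕ → List ℕ
insert a []       = a ∷ []
insert a (x ∷ xs) with x <? a
... | yes _ = x ∷ insert a xs
... | no _  = a ∷ x ∷ xs

remove : ℕ → List ℕ → List ℕ
remove b []       = []
remove b (x ∷ xs) with b ≟ x
... | yes _ = xs
... | no _  = x ∷ remove b xs

count-insert : ∀ j a xs → count j (insert a xs) ≡ count j (a ∷ xs)
count-insert j a []       = refl
count-insert j a (x ∷ xs) with x <? a
... | yes _ = trans (cong (occ x +_) (count-insert j a xs)) (x∙yz≈y∙xz (occ x) (occ a) (count j xs))
  where occ : ℕ → ℕ
        occ y = if does (y ≟ j) then 1 else 0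
... | no _  = refl

count-remove-≢ : ∀ j b xs → b ≢ j → count j (remove b xs) ≡ count j xs
count-remove-≢ j b []       _   = refl
count-remove-≢ j b (x ∷ xs) b≢j with b ≟ x
... | yes refl = sym (count-there j xs b≢j)
... | no _     = cong (occ x +_) (count-remove-≢ j b xs b≢j)
  where occ : ℕ → ℕ
        occ y = if does (y ≟ j) then 1 else 0

count-remove : ∀ b xs → 0 < count b xs → suc (count b (remove b xs)) ≡ count b xs
count-remove b (x ∷ xs) c with b ≟ x
... | yes refl = sym (count-here b xs)
... | no b≢x   rewrite count-there b xs (≢-sym b≢x) | count-there b (remove b xs) (≢-sym b≢x) =
  count-remove b xs c

length-insert : ∀ a xs → length (insert a xs) ≡ suc (length xs)
length-insert a []       = refl
length-insert a (x ∷ xs) with x <? a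
... | yes _ = cong suc (length-insert a xs)
... | no _  = refl

length-remove : ∀ b xs → 0 < count b xs → suc (length (remove b xs)) ≡ length xs
length-remove b (x ∷ xs) c with b ≟ x
... | yes _  = refl
... | no b≢x rewrite count-there b xs (≢-sym b≢x) = cong suc (length-remove b xs c)

insert-++ : ∀ a xs {y} ys → a ≤ y → insert a (xs ++ y ∷ ys) ≡ insert a xs ++ y ∷ ys
insert-++ a [] {y} ys a≤y with y <? a
... | yes y<a = ⊥-elim (<⇒≱ y<a a≤y)
... | no _    = refl
insert-++ a (x ∷ xs) ys a≤y with x <? a
... | yes _ = cong (x ∷_) (insert-++ a xs ys a≤y)
... | no _  = refl

remove-++ : ∀ b xs ys → 0 < count b xs → remove b (xs ++ ys) ≡ remove b xs ++ ys
remove-++ b (x ∷ xs) ys c with b ≟ x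
... | yes _  = refl
... | no b≢x rewrite count-there b xs (≢-sym b≢x) = cong (x ∷_) (remove-++ b xs ys c)

All-insert : ∀ {P : ℕ → Set} a xs → P a → All P xs → All P (insert a xs)
All-insert a []       pa _          = pa ∷ []
All-insert a (x ∷ xs) pa (px ∷ pxs) with x <? a
... | yes _ = px ∷ All-insert a xs pa pxs
... | no _  = pa ∷ px ∷ pxs

All-remove : ∀ {P : ℕ → Set} b xs → All P xs → All P (remove b xs)
All-remove b []       _          = []
All-remove b (x ∷ xs) (px ∷ pxs) with b ≟ x
... | yes _ = pxs
... | no _  = px ∷ All-remove b xs pxs

remove-insert : ∀ a xs → remove a (insert a xs) ≡ xs
remove-insert a [] rewrite ≟-diag (refl {x = a}) = refl
remove-insert a (x ∷ xs) with x <? a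
... | no _ rewrite ≟-diag (refl {x = a}) = refl
... | yes x<a with a ≟ x
...   | yes refl = ⊥-elim (<-irrefl refl x<a)
...   | no _     = cong (x ∷_) (remove-insert a xs)

Sorted : List ℕ → Set
Sorted = AllPairs _<_

Sorted-insert : ∀ a xs → All (_≢ a) xs → Sorted xs → Sorted (insert a xs)
Sorted-insert a []       _            _          = [] ∷ []
Sorted-insert a (x ∷ xs) (x≢a ∷ xs≢a) (x<xs ∷ s) with x <? a
... | yes x<a = All-insert a xs x<a x<xs ∷ Sorted-insert a xs xs≢a s
... | no x≮a  = (a<x ∷ All.map (<-trans a<x) x<xs) ∷ x<xs ∷ s
  where a<x = ≤∧≢⇒< (≮⇒≥ x≮a) (≢-sym x≢a)

Sorted-remove : ∀ b xs → Sorted xs → Sorted (remove b xs)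
Sorted-remove b []       _          = []
Sorted-remove b (x ∷ xs) (x<xs ∷ s) with b ≟ x
... | yes _ = s
... | no _  = All-remove b xs x<xs ∷ Sorted-remove b xs s

Sorted-map : ∀ (P : ℕ → Set) f xs → All P xs → (∀ {x y} → P x → P y → x < y → f x < f y) →
             Sorted xs → Sorted (map f xs)
Sorted-map P f []       _          _    _          = []
Sorted-map P f (x ∷ xs) (px ∷ pxs) mono (x<xs ∷ s) =
  All.map⁺ (All.zipWith (λ (py , x<y) → mono px py x<y) (pxs , x<xs)) ∷ Sorted-map P f xs pxs mono s

Sorted-++ˡ : ∀ xs ys → Sorted (xs ++ ys) → Sorted xs
Sorted-++ˡ []       ys _          = []
Sorted-++ˡ (x ∷ xs) ys (x<xs ∷ s) = All.++⁻ˡ xs x<xs ∷ Sorted-++ˡ xs ys s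

Sorted-∷ʳ⇒All< : ∀ xs m → Sorted (xs ++ m ∷ []) → All (_< m) xs
Sorted-∷ʳ⇒All< []       m _          = []
Sorted-∷ʳ⇒All< (x ∷ xs) m (x<xs ∷ s) = All.head (All.++⁻ʳ xs x<xs) ∷ Sorted-∷ʳ⇒All< xs m s

All<⇒All≢ : ∀ {m} xs → All (_< m) xs → All (_≢ m) xs
All<⇒All≢ xs = All.map <⇒≢

insert-remove : ∀ b xs → Sorted xs → 0 < count b xs → insert b (remove b xs) ≡ xs
insert-remove b (x ∷ xs) (x<xs ∷ s) c with b ≟ x
insert-remove b (x ∷ [])     _                  c | yes refl = refl
insert-remove b (x ∷ y ∷ xs) ((x<y ∷ _) ∷ _)    c | yes refl with y <? x
... | yes y<x = ⊥-elim (<-asym x<y y<x)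
... | no _    = refl
insert-remove b (x ∷ xs)     (x<xs ∷ s)         c | no b≢x rewrite count-there b xs (≢-sym b≢x) with x <? b
... | yes _   = cong (x ∷_) (insert-remove b xs s c)
... | no x≮b  = ⊥-elim (x≮b (All-count>0 b xs x<xs c))

-- 1-based, like pos; 0 is a junk value for out-of-range indices.
nth : List ℕ → ℕ → ℕ
nth (x ∷ xs) 1             = x
nth (x ∷ xs) (suc (suc i)) = nth xs (suc i)
nth _        _             = 0

nth-++ : ∀ xs ys i → i < length xs → nth (xs ++ ys) (suc i) ≡ nth xs (suc i)
nth-++ (x ∷ xs) ys zero    _         = refl
nth-++ (x ∷ xs) ys (suc i) (s≤s i<n) = nth-++ xs ys i i<n

count-nth>0 : ∀ xs i → i < length xs → 0 < count (nth xs (suc i)) xs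
count-nth>0 (x ∷ xs) zero    _ rewrite count-here x xs = z<s
count-nth>0 (x ∷ xs) (suc i) (s≤s i<n) with x ≟ nth xs (suc i)
... | yes refl rewrite count-here x xs = z<s
... | no x≢y   rewrite count-there (nth xs (suc i)) xs x≢y = count-nth>0 xs i i<n

pos>0 : ∀ a xs → 0 < count a xs → 0 < pos a xs
pos>0 a (x ∷ xs) _ with does (a ≟ x)
... | true  = z<s
... | false = z<s

nth-∷ : ∀ x xs {p} → 0 < p → nth (x ∷ xs) (suc p) ≡ nth xs p
nth-∷ x xs {suc p} _ = refl

nth-pos : ∀ a xs → 0 < count a xs → nth xs (pos a xs) ≡ a
nth-pos a (x ∷ xs) c with a ≟ x
... | yes refl rewrite pos-here a xs = refl
... | no a≢x rewrite pos-there a xs a≢x | count-there a xs (≢-sym a≢x) =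
  trans (nth-∷ x xs (pos>0 a xs c)) (nth-pos a xs c)

pos-++≤length : ∀ a xs ys → 0 < count a xs → pos a (xs ++ ys) ≤ length xs
pos-++≤length a (x ∷ xs) ys c with a ≟ x
... | yes refl rewrite pos-here a (xs ++ ys) = s≤s z≤n
... | no a≢x rewrite pos-there a (xs ++ ys) a≢x | count-there a xs (≢-sym a≢x) =
  s≤s (pos-++≤length a xs ys c)

pos-nth : ∀ xs ys i → Sorted xs → i < length xs → pos (nth xs (suc i)) (xs ++ ys) ≡ suc i
pos-nth (x ∷ xs) ys zero    _          _         = pos-here x (xs ++ ys)
pos-nth (x ∷ xs) ys (suc i) (x<xs ∷ s) (s≤s i<n) =
  trans (pos-there _ (xs ++ ys) x≢y) (cong suc (pos-nth xs ys i s i<n))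
  where x≢y = ≢-sym (<⇒≢ (All-count>0 (nth xs (suc i)) xs x<xs (count-nth>0 xs i i<n)))

pos-after : ∀ m xs ys → All (_≢ m) xs → pos m (xs ++ m ∷ ys) ≡ suc (length xs)
pos-after m []       ys _            = pos-here m ys
pos-after m (x ∷ xs) ys (x≢m ∷ xs≢m) =
  trans (pos-there m (xs ++ m ∷ ys) (≢-sym x≢m)) (cong suc (pos-after m xs ys xs≢m))

take-after : ∀ (m : ℕ) xs ys → take (suc (length xs)) (xs ++ m ∷ ys) ≡ xs ++ m ∷ []
take-after m []       ys = refl
take-after m (x ∷ xs) ys = cong (x ∷_) (take-after m xs ys)

asc-map : ∀ (P : ℕ → Set) f xs → All P xs →
          (∀ {x y} → P x → P y → x < y → f x < f y) → (∀ {x y} → P x → P y → f x < f y → x < y) →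
          asc (map f xs) ≡ asc xs
asc-map P f []           _                 _    _       = refl
asc-map P f (x ∷ [])     _                 _    _       = refl
asc-map P f (x ∷ y ∷ xs) (px ∷ py ∷ pxs) mono reflect
  with x <? y | asc-map P f (y ∷ xs) (py ∷ pxs) mono reflect
... | yes x<y | ih = trans (asc-< (map f xs) (mono px py x<y)) (trans (cong suc ih) (sym (asc-< xs x<y)))
... | no x≮y  | ih = trans (asc-≮ (map f xs) (λ fx<fy → x≮y (reflect px py fx<fy))) (trans ih (sym (asc-≮ xs x≮y)))

asc-max∷ : ∀ m ys → All (_< m) ys → asc (m ∷ ys) ≡ asc ys
asc-max∷ m []      _           = refl
asc-max∷ m (y ∷ ys) (y<m ∷ _) = asc-≮ ys (<-asym y<m)

-- Order-preserving relabelling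

punchIn : ℕ → ℕ → ℕ
punchIn a x with x <? a
... | yes _ = x
... | no _  = suc x

punchOut : ℕ → ℕ → ℕ
punchOut b x with b <? x
... | yes _ = pred x
... | no _  = x

punchIn-< : ∀ a {x} → x < a → punchIn a x ≡ x
punchIn-< a {x} x<a with x <? a
... | yes _  = refl
... | no x≮a = ⊥-elim (x≮a x<a)

punchIn-≥ : ∀ a {x} → a ≤ x → punchIn a x ≡ suc x
punchIn-≥ a {x} a≤x with x <? a
... | yes x<a = ⊥-elim (<⇒≱ x<a a≤x)
... | no _    = refl

punchOut-> : ∀ b {x} → b < x → punchOut b x ≡ pred x
punchOut-> b {x} b<x with b <? x
... | yes _  = refl
... | no b≮x = ⊥-elim (b≮x b<x)

punchOut-≤ : ∀ b {x} → x ≤ b → punchOut b x ≡ x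
punchOut-≤ b {x} x≤b with b <? x
... | yes b<x = ⊥-elim (<⇒≱ b<x x≤b)
... | no _    = refl

punchOut-punchIn : ∀ a x → punchOut a (punchIn a x) ≡ x
punchOut-punchIn a x with x <? a
... | yes x<a = punchOut-≤ a (<⇒≤ x<a)
... | no x≮a  = punchOut-> a (s≤s (≮⇒≥ x≮a))

punchIn-punchOut : ∀ b {x} → x ≢ b → punchIn b (punchOut b x) ≡ x
punchIn-punchOut b {x} x≢b with b <? x
punchIn-punchOut b {suc x} _   | yes b<x = punchIn-≥ b (≤-pred b<x)
punchIn-punchOut b {x}     x≢b | no b≮x  = punchIn-< b (≤∧≢⇒< (≮⇒≥ b≮x) x≢b)

punchIn≢ : ∀ a x → punchIn a x ≢ a
punchIn≢ a x with x <? a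
... | yes x<a = <⇒≢ x<a
... | no x≮a  = ≢-sym (<⇒≢ (s≤s (≮⇒≥ x≮a)))

punchIn-mono-< : ∀ a {x y} → x < y → punchIn a x < punchIn a y
punchIn-mono-< a {x} {y} x<y with x <? a | y <? a
... | yes _   | yes _   = x<y
... | yes _   | no _    = m<n⇒m<1+n x<y
... | no x≮a  | yes y<a = ⊥-elim (x≮a (<-trans x<y y<a))
... | no _    | no _    = s≤s x<y

punchIn-cancel-< : ∀ a {x y} → punchIn a x < punchIn a y → x < y
punchIn-cancel-< a {x} {y} lt with x <? a | y <? a
... | yes _   | yes _   = lt
... | yes x<a | no y≮a  = <-≤-trans x<a (≮⇒≥ y≮a)
... | no x≮a  | yes y<a = ⊥-elim (x≮a (<-trans (<-trans (n<1+n x) lt) y<a))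
... | no _    | no _    = ≤-pred lt

punchOut-mono-< : ∀ b {x y} → x ≢ b → y ≢ b → x < y → punchOut b x < punchOut b y
punchOut-mono-< b {x} {y} x≢b y≢b x<y with b <? x | b <? y
punchOut-mono-< b {suc x} {suc y} _   _ x<y | yes _   | yes _   = ≤-pred x<y
... | yes b<x | no b≮y  = ⊥-elim (b≮y (<-trans b<x x<y))
punchOut-mono-< b {x} {suc y} x≢b _ _   | no b≮x  | yes b<y = <-≤-trans (≤∧≢⇒< (≮⇒≥ b≮x) x≢b) (≤-pred b<y)
... | no _    | no _    = x<y

punchOut-cancel-< : ∀ b {x y} → x ≢ b → y ≢ b → punchOut b x < punchOut b y → x < y
punchOut-cancel-< b {x} {y} _ _ lt with b <? x | b <? y
punchOut-cancel-< b {suc x} {suc y} _ _ lt | yes _   | yes _   = s≤s lt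
punchOut-cancel-< b {suc x} {y}     _ _ lt | yes b<x | no b≮y  =
  ⊥-elim (<-irrefl refl (<-≤-trans (≤-<-trans (≤-pred b<x) lt) (≮⇒≥ b≮y)))
punchOut-cancel-< b {x}     {suc y} _ _ lt | no _    | yes _   = m<n⇒m<1+n lt
... | no _ | no _ = lt

count-punchIn-< : ∀ a j w → j < a → count j (map (punchIn a) w) ≡ count j w
count-punchIn-< a j w j<a = count-map (λ _ → ⊤) (punchIn a) j j w (All.universal _ w) from to
  where
  from : ∀ {x} → ⊤ → punchIn a x ≡ j → x ≡ j
  from {x} _ eq with x <? a
  ... | yes _  = eq
  ... | no x≮a = ⊥-elim (x≮a (<-trans (subst (x <_) eq (n<1+n x)) j<a))
  to : ∀ {x} → ⊤ → x ≡ j → punchIn a x ≡ j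
  to _ refl = punchIn-< a j<a

count-punchIn-≥ : ∀ a j w → a ≤ j → count (suc j) (map (punchIn a) w) ≡ count j w
count-punchIn-≥ a j w a≤j = count-map (λ _ → ⊤) (punchIn a) (suc j) j w (All.universal _ w) from to
  where
  from : ∀ {x} → ⊤ → punchIn a x ≡ suc j → x ≡ j
  from {x} _ eq with x <? a
  ... | yes x<a = ⊥-elim (<-irrefl eq (<-≤-trans x<a (m≤n⇒m≤1+n a≤j)))
  ... | no _    = suc-injective eq
  to : ∀ {x} → ⊤ → x ≡ j → punchIn a x ≡ suc j
  to _ refl = punchIn-≥ a a≤j

count-punchIn-≡ : ∀ a w → count a (map (punchIn a) w) ≡ 0
count-punchIn-≡ a w = All≢⇒count≡0 a (map (punchIn a) w) (All.map⁺ (All.universal (punchIn≢ a) w))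

count-punchOut-< : ∀ b j w → All (_≢ b) w → j < b → count j (map (punchOut b) w) ≡ count j w
count-punchOut-< b j w w≢b j<b = count-map (_≢ b) (punchOut b) j j w w≢b from to
  where
  from : ∀ {x} → x ≢ b → punchOut b x ≡ j → x ≡ j
  from {x} _ eq with b <? x
  from {suc x} _ eq | yes b<x = ⊥-elim (<-irrefl refl (<-≤-trans j<b (subst (b ≤_) eq (≤-pred b<x))))
  ... | no _ = eq
  to : ∀ {x} → x ≢ b → x ≡ j → punchOut b x ≡ j
  to _ refl = punchOut-≤ b (<⇒≤ j<b)

count-punchOut-≥ : ∀ b j w → All (_≢ b) w → b ≤ j → count j (map (punchOut b) w) ≡ count (suc j) w
count-punchOut-≥ b j w w≢b b≤j = count-map (_≢ b) (punchOut b) j (suc j) w w≢b from to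
  where
  from : ∀ {x} → x ≢ b → punchOut b x ≡ j → x ≡ suc j
  from {x} x≢b eq with b <? x
  from {suc x} _ eq | yes _ = cong suc eq
  ... | no b≮x = ⊥-elim (x≢b (≤-antisym (≮⇒≥ b≮x) (subst (b ≤_) (sym eq) b≤j)))
  to : ∀ {x} → x ≢ b → x ≡ suc j → punchOut b x ≡ j
  to _ refl = punchOut-> b (s≤s b≤j)

map-punchOut-punchIn : ∀ a w → map (punchOut a) (map (punchIn a) w) ≡ w
map-punchOut-punchIn a []      = refl
map-punchOut-punchIn a (x ∷ w) = cong₂ _∷_ (punchOut-punchIn a x) (map-punchOut-punchIn a w)

map-punchIn-punchOut : ∀ b w → All (_≢ b) w → map (punchIn b) (map (punchOut b) w) ≡ w
map-punchIn-punchOut b []      _           = refl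
map-punchIn-punchOut b (x ∷ w) (x≢b ∷ w≢b) = cong₂ _∷_ (punchIn-punchOut b x≢b) (map-punchIn-punchOut b w w≢b)

count≡1⇒remove≢ : ∀ b xs → count b xs ≡ 1 → All (_≢ b) (remove b xs)
count≡1⇒remove≢ b xs c =
  count≡0⇒All≢ b (remove b xs) (suc-injective (trans (count-remove b xs (subst (0 <_) (sym c) z<s)) c))

Bounded : ℕ → ℕ → Set
Bounded m x = 1 ≤ x × x ≤ m

IsPerm-count : ∀ m w → IsPerm m w → ∀ {j} → 1 ≤ j → j ≤ m → count j w ≡ 1
IsPerm-count m w (_ , counts) {suc j} _ j≤m = All.applyUpTo⁻ suc m counts j≤m

mkIsPerm : ∀ m w → All (Bounded m) w → (∀ {j} → 1 ≤ j → j ≤ m → count j w ≡ 1) → IsPerm m w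
mkIsPerm m w bounded counts = bounded , All.applyUpTo⁺₁ suc m (counts z<s)

insertLetter : ℕ → List ℕ → List ℕ
insertLetter a σ = insert a (map (punchIn a) σ)

removeLetter : ℕ → List ℕ → List ℕ
removeLetter b π = map (punchOut b) (remove b π)

IsPerm-insertLetter : ∀ n a σ → Bounded (suc n) a → IsPerm n σ → IsPerm (suc n) (insertLetter a σ)
IsPerm-insertLetter n a σ (1≤a , a≤1+n) perm = mkIsPerm (suc n) _ bounded counts
  where
  punchIn-bounded : ∀ {x} → Bounded n x → Bounded (suc n) (punchIn a x)
  punchIn-bounded {x} (1≤x , x≤n) with x <? a
  ... | yes _ = 1≤x , m≤n⇒m≤1+n x≤n
  ... | no _  = z<s , s≤s x≤n
  bounded : All (Bounded (suc n)) (insertLetter a σ)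
  bounded = All-insert a _ (1≤a , a≤1+n) (All.map⁺ (All.map punchIn-bounded (proj₁ perm)))
  counts : ∀ {j} → 1 ≤ j → j ≤ suc n → count j (insertLetter a σ) ≡ 1
  counts {j} 1≤j j≤1+n rewrite count-insert j a (map (punchIn a) σ) with <-cmp j a
  ... | tri< j<a _ _ = trans (count-there j (map (punchIn a) σ) (≢-sym (<⇒≢ j<a)))
                         (trans (count-punchIn-< a j σ j<a) (IsPerm-count n σ perm 1≤j (<⇒≤pred (<-≤-trans j<a a≤1+n))))
  ... | tri≈ _ refl _ = trans (count-here j (map (punchIn j) σ)) (cong suc (count-punchIn-≡ j σ))
  counts {suc j} _ j≤1+n | tri> _ _ a<j = trans (count-there (suc j) (map (punchIn a) σ) (<⇒≢ a<j))
                         (trans (count-punchIn-≥ a j σ (≤-pred a<j)) (IsPerm-count n σ perm (≤-trans 1≤a (≤-pred a<j)) (≤-pred j≤1+n)))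

IsPerm-removeLetter : ∀ n b π → Bounded (suc n) b → IsPerm (suc n) π → IsPerm n (removeLetter b π)
IsPerm-removeLetter n b π (1≤b , b≤1+n) perm = mkIsPerm n _ bounded counts
  where
  count-b : count b π ≡ 1
  count-b = IsPerm-count (suc n) π perm 1≤b b≤1+n
  rest≢b : All (_≢ b) (remove b π)
  rest≢b = count≡1⇒remove≢ b π count-b
  punchOut-bounded : ∀ {x} → Bounded (suc n) x × x ≢ b → Bounded n (punchOut b x)
  punchOut-bounded {x} ((1≤x , x≤1+n) , x≢b) with b <? x
  punchOut-bounded {suc x} ((_ , x≤1+n) , _) | yes b<x = ≤-trans 1≤b (≤-pred b<x) , ≤-pred x≤1+n
  ... | no b≮x = 1≤x , <⇒≤pred (<-≤-trans (≤∧≢⇒< (≮⇒≥ b≮x) x≢b) b≤1+n)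
  bounded : All (Bounded n) (removeLetter b π)
  bounded = All.map⁺ (All.map punchOut-bounded (All.zip (All-remove b π (proj₁ perm) , rest≢b)))
  counts : ∀ {j} → 1 ≤ j → j ≤ n → count j (removeLetter b π) ≡ 1
  counts {j} 1≤j j≤n with j <? b
  ... | yes j<b = trans (count-punchOut-< b j _ rest≢b j<b)
                    (trans (count-remove-≢ j b π (≢-sym (<⇒≢ j<b))) (IsPerm-count (suc n) π perm 1≤j (m≤n⇒m≤1+n j≤n)))
  ... | no j≮b  = trans (count-punchOut-≥ b j _ rest≢b (≮⇒≥ j≮b))
                    (trans (count-remove-≢ (suc j) b π (<⇒≢ (s≤s (≮⇒≥ j≮b)))) (IsPerm-count (suc n) π perm z<s (s≤s j≤n)))

-- The shape of a permutation in 𝒬_m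

split-at : ∀ m π → 0 < count m π → Σ[ u ∈ List ℕ ] Σ[ t ∈ List ℕ ] (π ≡ u ++ m ∷ t × All (_≢ m) u)
split-at m (x ∷ π) c with x ≟ m
... | yes refl = [] , π , refl , []
... | no x≢m rewrite count-there m π x≢m with split-at m π c
...   | u , t , refl , u≢m = x ∷ u , t , refl , x≢m ∷ u≢m

data Peaked (m : ℕ) : List ℕ → Set where
  peaked : ∀ u t → Sorted (u ++ m ∷ []) → All (_< m) t → Peaked m (u ++ m ∷ t)

pos-peak : ∀ u m t → Sorted (u ++ m ∷ []) → pos m (u ++ m ∷ t) ≡ suc (length u)
pos-peak u m t s = pos-after m u t (All<⇒All≢ u (Sorted-∷ʳ⇒All< u m s))

Q⇒Peaked : ∀ m π → 1 ≤ m → Q m π → Peaked m π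
Q⇒Peaked m π 1≤m (perm , inc) with split-at m π (subst (0 <_) (sym count-m) z<s)
  where count-m = IsPerm-count m π perm 1≤m ≤-refl
... | u , t , refl , u≢m rewrite pos-after m u t u≢m | take-after m u t =
  peaked u t (Linked⇒AllPairs <-trans inc) (All.zipWith (λ ((_ , x≤m) , x≢m) → ≤∧≢⇒< x≤m x≢m) (t-bounded , t≢m))
  where
  t-bounded : All (Bounded m) t
  t-bounded = All.tail (All.++⁻ʳ u (proj₁ perm))
  count-t : suc (count m t) ≡ 1
  count-t = begin
    suc (count m t)                 ≡⟨ cong (_+ suc (count m t)) (All≢⇒count≡0 m u u≢m) ⟨
    count m u + suc (count m t)     ≡⟨ cong (count m u +_) (count-here m t) ⟨
    count m u + count m (m ∷ t)     ≡⟨ count-++ m u (m ∷ t) ⟨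
    count m (u ++ m ∷ t)            ≡⟨ IsPerm-count m _ perm 1≤m ≤-refl ⟩
    1                               ∎
    where open ≡-Reasoning
  t≢m : All (_≢ m) t
  t≢m = count≡0⇒All≢ m t (suc-injective count-t)

Peaked⇒Q : ∀ m π → IsPerm m π → Peaked m π → Q m π
Peaked⇒Q m _ perm (peaked u t s _) rewrite pos-peak u m t s | take-after m u t = perm , AllPairs⇒Linked s

asc-peak : ∀ u m t → Sorted (u ++ m ∷ []) → All (_< m) t → asc (u ++ m ∷ t) ≡ length u + asc t
asc-peak []           m t _                 t<m = asc-max∷ m t t<m
asc-peak (x ∷ [])     m t ((x<m ∷ _) ∷ _)   t<m = trans (asc-< t x<m) (cong suc (asc-max∷ m t t<m))
asc-peak (x ∷ y ∷ u)  m t ((x<y ∷ _) ∷ s)   t<m =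
  trans (asc-< (u ++ m ∷ t) x<y) (cong suc (asc-peak (y ∷ u) m t s t<m))

count-insertLetter : ∀ a σ → count a (insertLetter a σ) ≡ 1
count-insertLetter a σ = trans (count-insert a a (map (punchIn a) σ))
                               (trans (count-here a (map (punchIn a) σ)) (cong suc (count-punchIn-≡ a σ)))

length-insertLetter : ∀ a σ → length (insertLetter a σ) ≡ suc (length σ)
length-insertLetter a σ = trans (length-insert a (map (punchIn a) σ)) (cong suc (length-map (punchIn a) σ))

Sorted-insertLetter : ∀ a σ → Sorted σ → Sorted (insertLetter a σ)
Sorted-insertLetter a σ s = Sorted-insert a (map (punchIn a) σ) (All.map⁺ (All.universal (punchIn≢ a) σ))
  (Sorted-map (λ _ → ⊤) (punchIn a) σ (All.universal _ σ) (λ _ _ → punchIn-mono-< a) s)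

insertLetter-++ : ∀ a u n t → a ≤ n → insertLetter a (u ++ n ∷ t) ≡ insertLetter a u ++ suc n ∷ map (punchIn a) t
insertLetter-++ a u n t a≤n = begin
  insert a (map (punchIn a) (u ++ n ∷ t))                         ≡⟨ cong (insert a) (map-++ (punchIn a) u (n ∷ t)) ⟩
  insert a (map (punchIn a) u ++ punchIn a n ∷ map (punchIn a) t) ≡⟨ cong (λ y → insert a (map (punchIn a) u ++ y ∷ map (punchIn a) t)) (punchIn-≥ a a≤n) ⟩
  insert a (map (punchIn a) u ++ suc n ∷ map (punchIn a) t)       ≡⟨ insert-++ a (map (punchIn a) u) (map (punchIn a) t) (m≤n⇒m≤1+n a≤n) ⟩
  insertLetter a u ++ suc n ∷ map (punchIn a) t                   ∎
  where open ≡-Reasoning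

Sorted-insertLetter-∷ʳ : ∀ a u n → a ≤ n → Sorted (u ++ n ∷ []) → Sorted (insertLetter a u ++ suc n ∷ [])
Sorted-insertLetter-∷ʳ a u n a≤n s = subst Sorted (insertLetter-++ a u n [] a≤n) (Sorted-insertLetter a (u ++ n ∷ []) s)

punchIn-below : ∀ a n t → All (_< n) t → All (_< suc n) (map (punchIn a) t)
punchIn-below a n t t<n = All.map⁺ (All.map below t<n)
  where
  below : ∀ {x} → x < n → punchIn a x < suc n
  below {x} x<n with x <? a
  ... | yes _ = m<n⇒m<1+n x<n
  ... | no _  = s≤s x<n

Peaked-insertLetter : ∀ a n σ → a ≤ n → Peaked n σ → Peaked (suc n) (insertLetter a σ)
Peaked-insertLetter a n _ a≤n (peaked u t s t<n) rewrite insertLetter-++ a u n t a≤n =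
  peaked (insertLetter a u) (map (punchIn a) t) (Sorted-insertLetter-∷ʳ a u n a≤n s) (punchIn-below a n t t<n)

asc-insertLetter : ∀ a n σ → a ≤ n → Peaked n σ → asc (insertLetter a σ) ≡ suc (asc σ)
asc-insertLetter a n _ a≤n (peaked u t s t<n) rewrite insertLetter-++ a u n t a≤n = begin
  asc (insertLetter a u ++ suc n ∷ map (punchIn a) t)     ≡⟨ asc-peak _ (suc n) _ (Sorted-insertLetter-∷ʳ a u n a≤n s) (punchIn-below a n t t<n) ⟩
  length (insertLetter a u) + asc (map (punchIn a) t)     ≡⟨ cong₂ _+_ (length-insertLetter a u) asc-t ⟩
  suc (length u + asc t)                                  ≡⟨ cong suc (asc-peak u n t s t<n) ⟨
  suc (asc (u ++ n ∷ t))                                  ∎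
  where
  open ≡-Reasoning
  asc-t : asc (map (punchIn a) t) ≡ asc t
  asc-t = asc-map (λ _ → ⊤) (punchIn a) t (All.universal _ t) (λ _ _ → punchIn-mono-< a) (λ _ _ → punchIn-cancel-< a)

pos-insertLetter<peak : ∀ a n σ → a ≤ n → Peaked n σ → pos a (insertLetter a σ) < pos (suc n) (insertLetter a σ)
pos-insertLetter<peak a n _ a≤n (peaked u t s _) rewrite insertLetter-++ a u n t a≤n
  | pos-peak (insertLetter a u) (suc n) (map (punchIn a) t) (Sorted-insertLetter-∷ʳ a u n a≤n s) =
  s≤s (pos-++≤length a (insertLetter a u) _ (subst (0 <_) (sym (count-insertLetter a u)) z<s))

<peak⇒≤asc : ∀ m π i → Peaked m π → i < pos m π → i ≤ asc π
<peak⇒≤asc m _ i (peaked u t s t<m) i<peak rewrite pos-peak u m t s | asc-peak u m t s t<m =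
  ≤-trans (≤-pred i<peak) (m≤m+n (length u) (asc t))

Sorted⇒remove≢ : ∀ b xs → Sorted xs → All (_≢ b) (remove b xs)
Sorted⇒remove≢ b []       _          = []
Sorted⇒remove≢ b (x ∷ xs) (x<xs ∷ s) with b ≟ x
... | yes refl = All.map (≢-sym ∘ <⇒≢) x<xs
... | no b≢x   = ≢-sym b≢x ∷ Sorted⇒remove≢ b xs s

Sorted-removeLetter : ∀ b xs → Sorted xs → Sorted (removeLetter b xs)
Sorted-removeLetter b xs s =
  Sorted-map (_≢ b) (punchOut b) (remove b xs) (Sorted⇒remove≢ b xs s) (punchOut-mono-< b) (Sorted-remove b xs s)

length-removeLetter : ∀ b xs → 0 < count b xs → suc (length (removeLetter b xs)) ≡ length xs
length-removeLetter b xs b∈xs = trans (cong suc (length-map (punchOut b) (remove b xs))) (length-remove b xs b∈xs)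

removeLetter-++ : ∀ b u n t → 0 < count b u → b ≤ n →
                  removeLetter b (u ++ suc n ∷ t) ≡ removeLetter b u ++ n ∷ map (punchOut b) t
removeLetter-++ b u n t b∈u b≤n = begin
  map (punchOut b) (remove b (u ++ suc n ∷ t))                          ≡⟨ cong (map (punchOut b)) (remove-++ b u (suc n ∷ t) b∈u) ⟩
  map (punchOut b) (remove b u ++ suc n ∷ t)                            ≡⟨ map-++ (punchOut b) (remove b u) (suc n ∷ t) ⟩
  removeLetter b u ++ punchOut b (suc n) ∷ map (punchOut b) t           ≡⟨ cong (λ y → removeLetter b u ++ y ∷ map (punchOut b) t) (punchOut-> b (s≤s b≤n)) ⟩
  removeLetter b u ++ n ∷ map (punchOut b) t                            ∎
  where open ≡-Reasoning

module RemoveBeforePeak (u t : List ℕ) (n b : ℕ) (s : Sorted (u ++ suc n ∷ [])) (t<peak : All (_< suc n) t)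
                        (b∈u : 0 < count b u) (t≢b : All (_≢ b) t) where

  b≤n : b ≤ n
  b≤n = ≤-pred (All-count>0 b u (Sorted-∷ʳ⇒All< u (suc n) s) b∈u)

  Sorted-removeLetter-∷ʳ : Sorted (removeLetter b u ++ n ∷ [])
  Sorted-removeLetter-∷ʳ = subst Sorted (removeLetter-++ b u n [] b∈u b≤n) (Sorted-removeLetter b (u ++ suc n ∷ []) s)

  punchOut-below : All (_< n) (map (punchOut b) t)
  punchOut-below = All.map⁺ (All.zipWith below (t<peak , t≢b))
    where
    below : ∀ {x} → x < suc n × x ≢ b → punchOut b x < n
    below {x} (x<1+n , x≢b) with b <? x
    below {suc x} (x<1+n , _) | yes _ = ≤-pred x<1+n
    ... | no b≮x = <-≤-trans (≤∧≢⇒< (≮⇒≥ b≮x) x≢b) b≤n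

  Peaked-removeLetter : Peaked n (removeLetter b (u ++ suc n ∷ t))
  Peaked-removeLetter rewrite removeLetter-++ b u n t b∈u b≤n =
    peaked (removeLetter b u) (map (punchOut b) t) Sorted-removeLetter-∷ʳ punchOut-below

  asc-removeLetter : suc (asc (removeLetter b (u ++ suc n ∷ t))) ≡ asc (u ++ suc n ∷ t)
  asc-removeLetter rewrite removeLetter-++ b u n t b∈u b≤n = begin
    suc (asc (removeLetter b u ++ n ∷ map (punchOut b) t))    ≡⟨ cong suc (asc-peak _ n _ Sorted-removeLetter-∷ʳ punchOut-below) ⟩
    suc (length (removeLetter b u) + asc (map (punchOut b) t)) ≡⟨ cong₂ _+_ (length-removeLetter b u b∈u) asc-t ⟩
    length u + asc t                                            ≡⟨ asc-peak u (suc n) t s t<peak ⟨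
    asc (u ++ suc n ∷ t)                                        ∎
    where
    open ≡-Reasoning
    asc-t : asc (map (punchOut b) t) ≡ asc t
    asc-t = asc-map (_≢ b) (punchOut b) t t≢b (punchOut-mono-< b) (punchOut-cancel-< b)

  insertLetter-removeLetter : insertLetter b (removeLetter b (u ++ suc n ∷ t)) ≡ u ++ suc n ∷ t
  insertLetter-removeLetter = begin
    insert b (map (punchIn b) (removeLetter b (u ++ suc n ∷ t))) ≡⟨ cong (insert b) (map-punchIn-punchOut b _ rest≢b) ⟩
    insert b (remove b (u ++ suc n ∷ t))                          ≡⟨ cong (insert b) (remove-++ b u (suc n ∷ t) b∈u) ⟩
    insert b (remove b u ++ suc n ∷ t)                            ≡⟨ insert-++ b (remove b u) t (m≤n⇒m≤1+n b≤n) ⟩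
    insert b (remove b u) ++ suc n ∷ t                            ≡⟨ cong (_++ suc n ∷ t) (insert-remove b u (Sorted-++ˡ u _ s) b∈u) ⟩
    u ++ suc n ∷ t                                                ∎
    where
    open ≡-Reasoning
    rest≢b : All (_≢ b) (remove b (u ++ suc n ∷ t))
    rest≢b rewrite remove-++ b u (suc n ∷ t) b∈u =
      All.++⁺ (Sorted⇒remove≢ b u (Sorted-++ˡ u _ s)) (≢-sym (<⇒≢ (s≤s b≤n)) ∷ t≢b)

length+lo≤max : ∀ lo xs m → Sorted (xs ++ m ∷ []) → All (lo ≤_) xs → lo ≤ m → length xs + lo ≤ m
length+lo≤max lo []       m _          _            lo≤m = lo≤m
length+lo≤max lo (x ∷ xs) m (x<rest ∷ s) (lo≤x ∷ lo≤xs) _ = begin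
  suc (length xs + lo) ≡⟨ +-suc (length xs) lo ⟨
  length xs + suc lo   ≤⟨ +-monoʳ-≤ (length xs) (s≤s lo≤x) ⟩
  length xs + suc x    ≤⟨ length+lo≤max (suc x) xs m s (All.++⁻ˡ xs x<rest) (All.head (All.++⁻ʳ xs x<rest)) ⟩
  m                    ∎
  where open ≤-Reasoning

pos-peak≤peak : ∀ m π → Peaked m π → All (Bounded m) π → pos m π ≤ m
pos-peak≤peak m _ (peaked u t s _) bounded rewrite pos-peak u m t s | +-comm 1 (length u) =
  length+lo≤max 1 u m s (All.map proj₁ (All.++⁻ˡ u bounded)) (proj₁ (All.head (All.++⁻ʳ u bounded)))

InHA : ℕ → ℕ → List ℕ → ℕ → Set
InHA n k σ a = Q n σ × (asc σ + 1 ≡ k) × (1 ≤ a × a ≤ n)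

InRFA : ℕ → ℕ → List ℕ → ℕ → Set
InRFA n k π i = Q (suc n) π × (asc π ≡ k) × ((1 ≤ i × i ≤ k) ⊎ i ≡ suc n) × (1 ≤ i × i < pos (suc n) π)

insertLetter-InRFA : ∀ n k σ a → InHA n k σ a → InRFA n k (insertLetter a σ) (pos a (insertLetter a σ))
insertLetter-InRFA n _ σ a (qσ , refl , 1≤a , a≤n) =
  Peaked⇒Q (suc n) π π-perm π-peaked , asc-π , inj₁ (0<i , subst (i ≤_) asc-π (<peak⇒≤asc (suc n) π i π-peaked i<peak)) , 0<i , i<peak
  where
  π = insertLetter a σ
  i = pos a π
  σ-peaked = Q⇒Peaked n σ (≤-trans 1≤a a≤n) qσ
  π-peaked = Peaked-insertLetter a n σ a≤n σ-peaked
  π-perm = IsPerm-insertLetter n a σ (1≤a , m≤n⇒m≤1+n a≤n) (proj₁ qσ)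
  asc-π : asc π ≡ asc σ + 1
  asc-π = trans (asc-insertLetter a n σ a≤n σ-peaked) (+-comm 1 (asc σ))
  i<peak = pos-insertLetter<peak a n σ a≤n σ-peaked
  0<i = pos>0 a π (subst (0 <_) (sym (count-insertLetter a σ)) z<s)

count-++≡1⇒All≢ʳ : ∀ b xs ys → count b (xs ++ ys) ≡ 1 → 0 < count b xs → All (_≢ b) ys
count-++≡1⇒All≢ʳ b xs ys once b∈xs = count≡0⇒All≢ b ys (n≤0⇒n≡0 (≤-pred (begin
  suc (count b ys)          ≤⟨ +-monoˡ-≤ (count b ys) b∈xs ⟩
  count b xs + count b ys   ≡⟨ count-++ b xs ys ⟨
  count b (xs ++ ys)        ≡⟨ once ⟩
  1                         ∎)))
  where open ≤-Reasoning

data BeforePeak (m : ℕ) : List ℕ → ℕ → Set where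
  beforePeak : ∀ u t j → Sorted (u ++ m ∷ []) → All (_< m) t → j < length u →
               All (_≢ nth u (suc j)) t → BeforePeak m (u ++ m ∷ t) (suc j)

InRFA⇒BeforePeak : ∀ n k π i → InRFA n k π i → BeforePeak (suc n) π i
InRFA⇒BeforePeak n k π zero    (_ , _ , _ , () , _)
InRFA⇒BeforePeak n k π (suc j) ((perm , inc) , _ , _ , _ , i<peak) with Q⇒Peaked (suc n) π z<s (perm , inc)
... | peaked u t s t<m = beforePeak u t j s t<m j<u (All.tail (count-++≡1⇒All≢ʳ b u (suc n ∷ t) once b∈u))
  where
  j<u : j < length u
  j<u = ≤-pred (subst (suc j <_) (pos-peak u (suc n) t s) i<peak)
  b = nth u (suc j)
  b∈u : 0 < count b u
  b∈u = count-nth>0 u j j<u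
  b-bounded : Bounded (suc n) b
  b-bounded = All-count>0 b u (All.++⁻ˡ u (proj₁ perm)) b∈u
  once : count b (u ++ suc n ∷ t) ≡ 1
  once = IsPerm-count (suc n) _ perm (proj₁ b-bounded) (proj₂ b-bounded)

removeLetter-InHA : ∀ n k π i → InRFA n k π i → InHA n k (removeLetter (nth π i) π) (nth π i)
removeLetter-InHA n k π i h@((perm , _) , refl , _) with InRFA⇒BeforePeak n k π i h
... | beforePeak u t j s t<m j<u t≢b rewrite nth-++ u (suc n ∷ t) j j<u =
  Peaked⇒Q n _ (IsPerm-removeLetter n b _ (1≤b , m≤n⇒m≤1+n b≤n) perm) Peaked-removeLetter ,
  trans (+-comm _ 1) asc-removeLetter , 1≤b , b≤n
  where
  b = nth u (suc j)
  b∈u = count-nth>0 u j j<u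
  open RemoveBeforePeak u t n b s t<m b∈u t≢b
  1≤b : 1 ≤ b
  1≤b = proj₁ (All-count>0 b u (All.++⁻ˡ u (proj₁ perm)) b∈u)

insertLetter-removeLetter-InRFA : ∀ n k π i → InRFA n k π i →
  insertLetter (nth π i) (removeLetter (nth π i) π) ≡ π × pos (nth π i) π ≡ i
insertLetter-removeLetter-InRFA n k π i h with InRFA⇒BeforePeak n k π i h
... | beforePeak u t j s t<m j<u t≢b rewrite nth-++ u (suc n ∷ t) j j<u =
  insertLetter-removeLetter , pos-nth u (suc n ∷ t) j (Sorted-++ˡ u _ s) j<u
  where open RemoveBeforePeak u t n (nth u (suc j)) s t<m (count-nth>0 u j j<u) t≢b

removeLetter-insertLetter : ∀ a σ → removeLetter a (insertLetter a σ) ≡ σ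
removeLetter-insertLetter a σ rewrite remove-insert a (map (punchIn a) σ) = map-punchOut-punchIn a σ

×-irrelevant : ∀ {A B : Set} → Irrelevant A → Irrelevant B → Irrelevant (A × B)
×-irrelevant irrA irrB (a , b) (a′ , b′) = cong₂ _,_ (irrA a a′) (irrB b b′)

Bounded-irrelevant : ∀ m x → Irrelevant (Bounded m x)
Bounded-irrelevant m x = ×-irrelevant ≤-irrelevant ≤-irrelevant

Q-irrelevant : ∀ m π → Irrelevant (Q m π)
Q-irrelevant m π = ×-irrelevant (×-irrelevant (All.irrelevant (Bounded-irrelevant m _)) (All.irrelevant ≡-irrelevant))
                                (Linked.irrelevant <-irrelevant)

InHA-irrelevant : ∀ n k σ a → Irrelevant (InHA n k σ a)
InHA-irrelevant n k σ a = ×-irrelevant (Q-irrelevant n σ) (×-irrelevant ≡-irrelevant (Bounded-irrelevant n a))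

-- The alternative i = n + 1 never occurs, since i < pos (n + 1) π ≤ n + 1.
InRFA-irrelevant : ∀ n k π i → Irrelevant (InRFA n k π i)
InRFA-irrelevant n k π i h@(qπ , _ , _ , _ , i<peak) =
  ×-irrelevant (Q-irrelevant (suc n) π) (×-irrelevant ≡-irrelevant (×-irrelevant index-irrelevant (×-irrelevant ≤-irrelevant ≤-irrelevant))) h
  where
  i≢1+n : i ≢ suc n
  i≢1+n = <⇒≢ (<-≤-trans i<peak (pos-peak≤peak (suc n) π (Q⇒Peaked (suc n) π z<s qπ) (proj₁ (proj₁ qπ))))
  index-irrelevant : Irrelevant ((1 ≤ i × i ≤ k) ⊎ i ≡ suc n)
  index-irrelevant (inj₁ p) (inj₁ p′) = cong inj₁ (×-irrelevant ≤-irrelevant ≤-irrelevant p p′)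
  index-irrelevant (inj₂ e) _         = ⊥-elim (i≢1+n e)
  index-irrelevant _        (inj₂ e)  = ⊥-elim (i≢1+n e)

lemma2p10 : (n k : ℕ) → 1 ≤ n → HA n k ⤖ RFA n k
lemma2p10 n k _ = ↔⇒⤖ (mk↔ₛ′ to from to∘from from∘to)
  where
  to : HA n k → RFA n k
  to ((σ , a) , h) = (insertLetter a σ , pos a (insertLetter a σ)) , insertLetter-InRFA n k σ a h
  from : RFA n k → HA n k
  from ((π , i) , h) = (removeLetter (nth π i) π , nth π i) , removeLetter-InHA n k π i h
  to∘from : ∀ y → to (from y) ≡ y
  to∘from ((π , i) , h) with insertLetter-removeLetter-InRFA n k π i h
  ... | π≡ , i≡ = Σ-≡,≡→≡ (cong₂ _,_ π≡ (trans (cong (pos (nth π i)) π≡) i≡) , InRFA-irrelevant n k π i _ h)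
  from∘to : ∀ x → from (to x) ≡ x
  from∘to ((σ , a) , h) = Σ-≡,≡→≡ (cong₂ _,_ σ≡ a≡ , InHA-irrelevant n k σ a _ h)
    where
    a≡ : nth (insertLetter a σ) (pos a (insertLetter a σ)) ≡ a
    a≡ = nth-pos a (insertLetter a σ) (subst (0 <_) (sym (count-insertLetter a σ)) z<s)
    σ≡ : removeLetter (nth (insertLetter a σ) (pos a (insertLetter a σ))) (insertLetter a σ) ≡ σ
    σ≡ = trans (cong (λ b → removeLetter b (insertLetter a σ)) a≡) (removeLetter-insertLetter a σ)
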